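{- Let $G$ be a graph on $n$ vertices, and let the sizes of the connected components of $G$ be $a_1 \le a_2 \le \dots \le a_r$. Then $\tilde{\alpha}(G) = n$ if and only if $a_i - 1 \le A_{i-1}$ for all $i = 1, \dots, r$, where $A_{i-1} = \sum_{k=1}^{i-1} a_k$ (so $A_0 = 0$).
   Context: All graphs are finite and simple. For positive integers $s,t$, an $(s,t)$-bipartite-hole of $G$ is a pair of disjoint vertex sets $S,T$ with $|S|=s$, $|T|=t$ and no edge of $G$ between $S$ and $T$. The bipartite-hole-number $\tilde{\alpha}(G)$ is the minimum integer $k$ such that there exist positive integers $s,t$ with $s+t=k+1$ for which $G$ contains no $(s,t)$-bipartite-hole. -}

module Defs where

open import Data.Nat using (ℕ; zero; suc; _+_; _∸_; _≤_; _<_)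
open import Data.Bool using (Bool; true; false)
open import Data.Fin using (Fin)
import Data.Fin as F
open import Data.Fin.Subset using (Subset; _∈_; ∣_∣)
open import Data.Vec using (tabulate)
open import Data.List using (List; allFin; filter; map)
open import Data.Nat.ListAction using (sum)
open import Data.Product using (Σ; ∃; _×_; _,_)
open import Relation.Nullary using (¬_; does)
open import Relation.Binary.PropositionalEquality using (_≡_)

record Graph (n : ℕ) : Set where
  field
    adj    : Fin n → Fin n → Bool
    sym    : ∀ u v → adj u v ≡ adj v u
    irrefl : ∀ v → adj v v ≡ false
open Graph public

data Reach {n : ℕ} (G : Graph n) : Fin n → Fin n → Set where
  here : ∀ {v} → Reach G v v
  step : ∀ {u v w} → adj G u v ≡ true → Reach G v w → Reach G u w

BipartiteHole : {n : ℕ} → Graph n → ℕ → ℕ → Set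
BipartiteHole {n} G s t =
  Σ (Subset n) λ S → Σ (Subset n) λ T →
    (∣ S ∣ ≡ s) × (∣ T ∣ ≡ t) ×
    (∀ v → v ∈ S → ¬ (v ∈ T)) ×
    (∀ u v → u ∈ S → v ∈ T → adj G u v ≡ false)

NoHoleAt : {n : ℕ} → Graph n → ℕ → Set
NoHoleAt G k = Σ ℕ λ s → Σ ℕ λ t →
  (1 ≤ s) × (1 ≤ t) × (s + t ≡ suc k) × ¬ BipartiteHole G s t

IsBipartiteHoleNumber : {n : ℕ} → Graph n → ℕ → Set
IsBipartiteHoleNumber G k = NoHoleAt G k × (∀ j → j < k → ¬ NoHoleAt G j)

record Components {n : ℕ} (G : Graph n) (r : ℕ) : Set where
  field
    label    : Fin n → Fin r
    surj     : ∀ i → ∃ λ v → label v ≡ i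
    sound    : ∀ u v → label u ≡ label v → Reach G u v
    complete : ∀ u v → Reach G u v → label u ≡ label v
open Components public

compSize : {n r : ℕ} {G : Graph n} → Components G r → Fin r → ℕ
compSize C i = ∣ tabulate (λ v → does (label C v F.≟ i)) ∣

Sorted : {n r : ℕ} {G : Graph n} → Components G r → Set
Sorted C = ∀ i j → i F.≤ j → compSize C i ≤ compSize C j

prefixSum : {n r : ℕ} {G : Graph n} → Components G r → Fin r → ℕ
prefixSum {r = r} C i = sum (map (compSize C) (filter (λ k → k F.<? i) (allFin r)))

{-# OPTIONS --safe #-}
-- If the components satisfy a_i ≤ 1 + A_{i-1}, then every s ≤ n is the total size of some
-- set of components (the greedy subset-sum argument behind Brown's criterion for complete
-- sequences); such a union of components together with any t ≤ n - s vertices outside it is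
-- an (s,t)-bipartite-hole, so no k < n is admissible. Conversely, if a_i ≥ A_{i-1} + 2, take
-- s = A_{i-1} + 1 and t = n - s. An (s,t)-hole covers every vertex, so its side S is a union
-- of components; each of them has size at most s < a_i, hence index below i by sortedness,
-- which forces s = |S| ≤ A_{i-1}. So there is no (s,t)-hole and n - 1 is admissible.
module Submission where

open import Defs
open import Data.Nat using (ℕ; _∸_; _≤_)
open import Data.Fin using (Fin)
open import Data.Product using (_×_)

open import Data.Bool using (Bool; true; false; if_then_else_)
open import Data.Bool.Properties using (if-eta; not-¬; ¬-not)
open import Data.Fin using (zero; suc; _≟_; _<?_)
open import Data.Fin.Subset using (Subset; _∈_; _∉_; _⊆_; ∣_∣; ∁; ⊥; ⊤; inside; outside)
open import Data.Fin.Subset.Properties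
  using ( _∈?_; ⊥⊆; ∣⊥∣≡0; ∣⊤∣≡n; ∣p∣≤n; in⊆in; s⊆s; p⊆q⇒∣p∣≤∣q∣; p⊂q⇒∣p∣<∣q∣
        ; ∣∁p∣≡n∸∣p∣; x∈∁p⇒x∉p; x∉p⇒x∈∁p)
open import Data.List using (filter; map)
import Data.List as List
open import Data.Nat using (zero; suc; _+_; _<_; _≰_; z≤n; s≤s; s≤s⁻¹; _≤?_)
open import Data.Nat.ListAction using () renaming (sum to sumₗ)
open import Data.Nat.Properties
  using ( +-0-commutativeMonoid; +-assoc; +-comm; +-identityʳ; +-monoʳ-≤; +-monoʳ-<
        ; ≤-refl; ≤-reflexive; ≤-trans; <-≤-trans; <⇒≤; <⇒≢; <⇒≱; ≰⇒>; 1+n≰n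
        ; m≤n+m∸n; m∸n+n≡m; m+[n∸m]≡n; m≤n+o⇒m∸n≤o; m+n≤o⇒m≤o; m+n≤o⇒m≤o∸n; m<n⇒0<n∸m
        ; module ≤-Reasoning)
open import Algebra.Properties.CommutativeMonoid.Sum +-0-commutativeMonoid
  using (sum; ∑-comm; sum-cong-≗; sum-replicate-zero)
open import Data.Product using (∃; ∃₂; _,_; proj₁)
open import Data.Sum using (_⊎_; inj₁; inj₂)
open import Data.Vec using ([]; _∷_; tabulate; lookup)
open import Data.Vec.Properties
  using (lookup∘tabulate; tabulate∘lookup; tabulate-cong; lookup-replicate; []=⇒lookup; lookup⇒[]=)
open import Function using (_∘_; id)
open import Level using (Level)
open import Relation.Binary.PropositionalEquality hiding (sym)
import Relation.Binary.PropositionalEquality as ≡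
open import Relation.Nullary using (¬_; does; yes; no; contradiction)
open import Relation.Nullary.Decidable using (dec-true)
open import Relation.Unary using (Pred; Decidable)

private variable
  ℓ : Level
  A : Set
  n r t : ℕ

∑⟨_⟩ : (Fin r → Bool) → (Fin r → ℕ) → ℕ
∑⟨ q ⟩ a = sum (λ k → if q k then a k else 0)

sumBelow : (Fin r → ℕ) → Fin r → ℕ
sumBelow a i = ∑⟨ (λ k → does (k <? i)) ⟩ a

sumBelow-zero : (a : Fin (suc r) → ℕ) → sumBelow a zero ≡ 0
sumBelow-zero {r = r} a = sum-replicate-zero r

∑-if-float : ∀ b (g : Fin n → ℕ) → sum (λ v → if b then g v else 0) ≡ (if b then sum g else 0)
∑-if-float         true  g = refl
∑-if-float {n = n} false g = sum-replicate-zero n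

∑⟨⟩-δ : (q : Fin r → Bool) (x : Fin r) →
        ∑⟨ q ⟩ (λ k → if does (x ≟ k) then 1 else 0) ≡ (if q x then 1 else 0)
∑⟨⟩-δ {r = suc r} q zero    = trans (cong ((if q zero then 1 else 0) +_) ∑0≡0) (+-identityʳ _)
  where
  ∑0≡0 : sum (λ k → if q (suc k) then 0 else 0) ≡ 0
  ∑0≡0 = trans (sum-cong-≗ (λ k → if-eta (q (suc k)))) (sum-replicate-zero r)
∑⟨⟩-δ             q (suc x) = cong₂ _+_ (if-eta (q zero)) (∑⟨⟩-δ (q ∘ suc) x)

sumₗ-filter-tabulate : {P : Pred A ℓ} (P? : Decidable P) (f : A → ℕ) (h : Fin r → A) →
  sumₗ (map f (filter P? (List.tabulate h))) ≡ ∑⟨ (λ k → does (P? (h k))) ⟩ (f ∘ h)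
sumₗ-filter-tabulate {r = zero}  P? f h = refl
sumₗ-filter-tabulate {r = suc r} P? f h with does (P? (h zero))
... | true  = cong (f (h zero) +_) (sumₗ-filter-tabulate P? f (h ∘ suc))
... | false = sumₗ-filter-tabulate P? f (h ∘ suc)

∈-tabulate⁺ : {p : Fin n → Bool} {v : Fin n} → p v ≡ true → v ∈ tabulate p
∈-tabulate⁺ {p = p} pv = lookup⇒[]= _ _ (trans (lookup∘tabulate p _) pv)

∈-tabulate⁻ : {p : Fin n → Bool} {v : Fin n} → v ∈ tabulate p → p v ≡ true
∈-tabulate⁻ {p = p} v∈ = trans (≡.sym (lookup∘tabulate p _)) ([]=⇒lookup v∈)

tabulate-true≡⊤ : tabulate (λ (_ : Fin n) → true) ≡ ⊤
tabulate-true≡⊤ = trans (tabulate-cong (λ v → ≡.sym (lookup-replicate v inside))) (tabulate∘lookup ⊤)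

∣tabulate∣≡∑⟨⟩1 : (p : Fin n → Bool) → ∣ tabulate p ∣ ≡ ∑⟨ p ⟩ (λ _ → 1)
∣tabulate∣≡∑⟨⟩1 {n = zero}  p = refl
∣tabulate∣≡∑⟨⟩1 {n = suc n} p with p zero
... | true  = cong suc (∣tabulate∣≡∑⟨⟩1 (p ∘ suc))
... | false = ∣tabulate∣≡∑⟨⟩1 (p ∘ suc)

∣preimage∣≡∑⟨⟩ : (f : Fin n → Fin r) (q : Fin r → Bool) →
  ∣ tabulate (q ∘ f) ∣ ≡ ∑⟨ q ⟩ (λ k → ∣ tabulate (λ v → does (f v ≟ k)) ∣)
∣preimage∣≡∑⟨⟩ {n = n} {r = r} f q = begin
  ∣ tabulate (q ∘ f) ∣                              ≡⟨ ∣tabulate∣≡∑⟨⟩1 (q ∘ f) ⟩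
  sum (λ v → if q (f v) then 1 else 0)              ≡⟨ sum-cong-≗ (λ v → ∑⟨⟩-δ q (f v)) ⟨
  sum (λ v → sum (λ k → if q k then δ v k else 0))  ≡⟨ ∑-comm (λ v k → if q k then δ v k else 0) ⟩
  sum (λ k → sum (λ v → if q k then δ v k else 0))  ≡⟨ sum-cong-≗ (λ k → ∑-if-float (q k) (δ′ k)) ⟩
  sum (λ k → if q k then sum (δ′ k) else 0)         ≡⟨ sum-cong-≗ (λ k → cong (if q k then_else 0)
                                                                       (∣tabulate∣≡∑⟨⟩1 (fibre k))) ⟨
  ∑⟨ q ⟩ (λ k → ∣ tabulate (fibre k) ∣)               ∎
  where
  open ≡-Reasoning
  fibre : Fin r → Fin n → Bool
  fibre k v = does (f v ≟ k)
  δ : Fin n → Fin r → ℕ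
  δ v k = if fibre k v then 1 else 0
  δ′ : Fin r → Fin n → ℕ
  δ′ k v = δ v k

∣p∣+∣∁p∣≡n : (p : Subset n) → ∣ p ∣ + ∣ ∁ p ∣ ≡ n
∣p∣+∣∁p∣≡n p = trans (cong (∣ p ∣ +_) (∣∁p∣≡n∸∣p∣ p)) (m+[n∸m]≡n (∣p∣≤n p))

q⊆∁p⇒∣p∣+∣q∣≤n : {p q : Subset n} → q ⊆ ∁ p → ∣ p ∣ + ∣ q ∣ ≤ n
q⊆∁p⇒∣p∣+∣q∣≤n {p = p} q⊆∁p =
  ≤-trans (+-monoʳ-≤ ∣ p ∣ (p⊆q⇒∣p∣≤∣q∣ q⊆∁p)) (≤-reflexive (∣p∣+∣∁p∣≡n p))

∣p∣+∣q∣≡n⇒∁p⊆q : {p q : Subset n} → q ⊆ ∁ p → ∣ p ∣ + ∣ q ∣ ≡ n → ∁ p ⊆ q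
∣p∣+∣q∣≡n⇒∁p⊆q {p = p} {q} q⊆∁p ∣p∣+∣q∣≡n {x} x∈∁p with x ∈? q
... | yes x∈q = x∈q
... | no  x∉q = contradiction ∣p∣+∣q∣≡n (<⇒≢ (begin-strict
  ∣ p ∣ + ∣ q ∣   <⟨ +-monoʳ-< ∣ p ∣ (p⊂q⇒∣p∣<∣q∣ (q⊆∁p , x , x∈∁p , x∉q)) ⟩
  ∣ p ∣ + ∣ ∁ p ∣ ≡⟨ ∣p∣+∣∁p∣≡n p ⟩
  _               ∎))
  where open ≤-Reasoning

subset-of-size : (p : Subset n) (t : ℕ) → t ≤ ∣ p ∣ → ∃ λ q → q ⊆ p × ∣ q ∣ ≡ t
subset-of-size {n = n} p     zero    _     = ⊥ , ⊥⊆ , ∣⊥∣≡0 n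
subset-of-size (inside ∷ p)  (suc t) t<∣p∣ with subset-of-size p t (s≤s⁻¹ t<∣p∣)
... | q , q⊆p , ∣q∣≡t = inside ∷ q , in⊆in q⊆p , cong suc ∣q∣≡t
subset-of-size (outside ∷ p) (suc t) t<∣p∣ with subset-of-size p (suc t) t<∣p∣
... | q , q⊆p , ∣q∣≡t = outside ∷ q , s⊆s q⊆p , ∣q∣≡t

∸1≰⇒suc< : ∀ {m} n → n ∸ 1 ≰ m → suc m < n
∸1≰⇒suc< zero    0≰m = contradiction z≤n 0≰m
∸1≰⇒suc< (suc n) n≰m = s≤s (≰⇒> n≰m)

skip-or-take : ∀ {a b B} → a ∸ 1 ≤ B → b ≤ B + a → b ≤ B ⊎ (a ≤ b × b ∸ a ≤ B)
skip-or-take {a} {b} {B} a∸1≤B b≤B+a with b ≤? B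
... | yes b≤B = inj₁ b≤B
... | no  b≰B = inj₂ (≤-trans (m≤n+m∸n a 1) (≤-trans (s≤s a∸1≤B) (≰⇒> b≰B)) ,
                      m≤n+o⇒m∸n≤o b a (≤-trans b≤B+a (≤-reflexive (+-comm B a))))

SubsetSumUpTo : (Fin r → ℕ) → ℕ → ℕ → Set
SubsetSumUpTo a B s = ∃₂ λ (Q : Subset _) b → b ≤ B × b + ∑⟨ lookup Q ⟩ a ≡ s

-- The slack B absorbs the total of the components already passed over by the induction.
subsetSums-complete : (a : Fin r → ℕ) (B : ℕ) → (∀ k → a k ∸ 1 ≤ B + sumBelow a k) →
                      ∀ s → s ≤ B + sum a → SubsetSumUpTo a B s
subsetSums-complete {r = zero}  a B _    s s≤B+0 =
  [] , s , ≤-trans s≤B+0 (≤-reflexive (+-identityʳ B)) , +-identityʳ s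
subsetSums-complete {r = suc r} a B cond s s≤B+∑a =
  extend (subsetSums-complete (a ∘ suc) (B + a zero)
           (λ k → ≤-trans (cond (suc k)) (≤-reflexive (≡.sym (+-assoc B (a zero) _))))
           s (≤-trans s≤B+∑a (≤-reflexive (≡.sym (+-assoc B (a zero) _)))))
  where
  a₀∸1≤B : a zero ∸ 1 ≤ B
  a₀∸1≤B = ≤-trans (cond zero) (≤-reflexive (trans (cong (B +_) (sumBelow-zero a)) (+-identityʳ B)))

  extend : SubsetSumUpTo (a ∘ suc) (B + a zero) s → SubsetSumUpTo a B s
  extend (Q , b , b≤B+a₀ , b+∑Q≡s) with skip-or-take a₀∸1≤B b≤B+a₀
  ... | inj₁ b≤B             = outside ∷ Q , b , b≤B , b+∑Q≡s
  ... | inj₂ (a₀≤b , b∸a₀≤B) = inside ∷ Q , b ∸ a zero , b∸a₀≤B , (begin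
    b ∸ a zero + (a zero + ∑Q) ≡⟨ +-assoc (b ∸ a zero) (a zero) ∑Q ⟨
    b ∸ a zero + a zero + ∑Q   ≡⟨ cong (_+ ∑Q) (m∸n+n≡m a₀≤b) ⟩
    b + ∑Q                     ≡⟨ b+∑Q≡s ⟩
    s                          ∎)
    where
    open ≡-Reasoning
    ∑Q = ∑⟨ lookup Q ⟩ (a ∘ suc)

disjoint⇒⊆∁ : {S T : Subset n} → (∀ v → v ∈ S → v ∉ T) → T ⊆ ∁ S
disjoint⇒⊆∁ disjoint v∈T = x∉p⇒x∈∁p (λ v∈S → disjoint _ v∈S v∈T)

Closed : Graph n → Subset n → Set
Closed G S = ∀ {u v} → u ∈ S → adj G u v ≡ true → v ∈ S

Closed⇒Reach-closed : {G : Graph n} {S : Subset n} → Closed G S →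
                      ∀ {u v} → Reach G u v → u ∈ S → v ∈ S
Closed⇒Reach-closed closed here       u∈S = u∈S
Closed⇒Reach-closed closed (step e r) u∈S = Closed⇒Reach-closed closed r (closed u∈S e)

hole⇒s+t≤n : (G : Graph n) {s t : ℕ} → BipartiteHole G s t → s + t ≤ n
hole⇒s+t≤n G (S , T , refl , refl , disjoint , _) = q⊆∁p⇒∣p∣+∣q∣≤n (disjoint⇒⊆∁ disjoint)

noHoleAt-n : (G : Graph n) → 1 ≤ n → NoHoleAt G n
noHoleAt-n {n = n} G 1≤n = 1 , n , ≤-refl , 1≤n , refl , λ hole → 1+n≰n (hole⇒s+t≤n G hole)

spanning-hole-closed : (G : Graph n) {s t : ℕ} (hole : BipartiteHole G s t) →
                       s + t ≡ n → Closed G (proj₁ hole)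
spanning-hole-closed G (S , T , refl , refl , disjoint , no-edge) ∣S∣+∣T∣≡n {u} {v} u∈S e
  with v ∈? S
... | yes v∈S = v∈S
... | no  v∉S = contradiction (no-edge u v u∈S (∁S⊆T (x∉p⇒x∈∁p v∉S))) (not-¬ e)
  where ∁S⊆T = ∣p∣+∣q∣≡n⇒∁p⊆q (disjoint⇒⊆∁ disjoint) ∣S∣+∣T∣≡n

closed⇒hole : (G : Graph n) (S : Subset n) → Closed G S → t ≤ n ∸ ∣ S ∣ → BipartiteHole G ∣ S ∣ t
closed⇒hole G S closed t≤n∸∣S∣
  with subset-of-size (∁ S) _ (subst (_ ≤_) (≡.sym (∣∁p∣≡n∸∣p∣ S)) t≤n∸∣S∣)
... | T , T⊆∁S , ∣T∣≡t = S , T , refl , ∣T∣≡t , (λ v v∈S v∈T → x∈∁p⇒x∉p (T⊆∁S v∈T) v∈S) , no-edge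
  where
  no-edge : ∀ u v → u ∈ S → v ∈ T → adj G u v ≡ false
  no-edge u v u∈S v∈T = ¬-not (λ e → x∈∁p⇒x∉p (T⊆∁S v∈T) (closed u∈S e))

module _ {G : Graph n} (C : Components G r) where

  label⁻¹-closed : (q : Fin r → Bool) → Closed G (tabulate (q ∘ label C))
  label⁻¹-closed q {u} {v} u∈ e =
    ∈-tabulate⁺ (subst (λ k → q k ≡ true) (complete C u v (step e here)) (∈-tabulate⁻ u∈))

  compSize≤∣closed∣ : {S : Subset n} → Closed G S → ∀ {u} → u ∈ S → compSize C (label C u) ≤ ∣ S ∣
  compSize≤∣closed∣ {S} closed {u} u∈S = p⊆q⇒∣p∣≤∣q∣ component⊆S
    where
    component⊆S : tabulate (λ w → does (label C w ≟ label C u)) ⊆ S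
    component⊆S {w} w∈ with label C w ≟ label C u | ∈-tabulate⁻ w∈
    ... | yes lw≡lu | _ = Closed⇒Reach-closed closed (sound C u w (≡.sym lw≡lu)) u∈S
    ... | no  _     | ()

  ∑compSize≡n : sum (compSize C) ≡ n
  ∑compSize≡n = begin
    sum (compSize C)                    ≡⟨ ∣preimage∣≡∑⟨⟩ (label C) (λ _ → true) ⟨
    ∣ tabulate (λ (_ : Fin n) → true) ∣ ≡⟨ cong ∣_∣ (tabulate-true≡⊤ {n}) ⟩
    ∣ ⊤ {n} ∣                           ≡⟨ ∣⊤∣≡n n ⟩
    n                                   ∎
    where open ≡-Reasoning

  prefixSum≡sumBelow : (i : Fin r) → prefixSum C i ≡ sumBelow (compSize C) i
  prefixSum≡sumBelow i = sumₗ-filter-tabulate (_<? i) (compSize C) id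

  componentUnion-hole : ∀ {s} → SubsetSumUpTo (compSize C) 0 s → t ≤ n ∸ s → BipartiteHole G s t
  componentUnion-hole {t = t} (Q , .0 , z≤n , ∑Q≡s) t≤n∸s =
    subst (λ m → BipartiteHole G m t) ∣S∣≡s
      (closed⇒hole G S (label⁻¹-closed (lookup Q)) (subst (λ m → t ≤ n ∸ m) (≡.sym ∣S∣≡s) t≤n∸s))
    where
    S = tabulate (lookup Q ∘ label C)
    ∣S∣≡s = trans (∣preimage∣≡∑⟨⟩ (label C) (lookup Q)) ∑Q≡s

  condition-sufficient : (∀ i → compSize C i ∸ 1 ≤ sumBelow (compSize C) i) →
                         ∀ j → j < n → ¬ NoHoleAt G j
  condition-sufficient cond j j<n (s , t , _ , _ , s+t≡1+j , no-hole) =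
    no-hole (componentUnion-hole (subsetSums-complete (compSize C) 0 cond s s≤∑a) t≤n∸s)
    where
    s+t≤n : s + t ≤ n
    s+t≤n = subst (_≤ n) (≡.sym s+t≡1+j) j<n
    s≤∑a : s ≤ sum (compSize C)
    s≤∑a = ≤-trans (m+n≤o⇒m≤o s s+t≤n) (≤-reflexive (≡.sym ∑compSize≡n))
    t≤n∸s : t ≤ n ∸ s
    t≤n∸s = m+n≤o⇒m≤o∸n t (≤-trans (≤-reflexive (+-comm t s)) s+t≤n)

  large-component⇒hole-free : Sorted C → (i : Fin r) →
    let s = suc (sumBelow (compSize C) i) in
    s < compSize C i → s + t ≡ n → ¬ BipartiteHole G s t
  large-component⇒hole-free sorted i s<aᵢ s+t≡n hole@(S , _ , ∣S∣≡s , _) = 1+n≰n (begin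
    suc P                                      ≡⟨ ∣S∣≡s ⟨
    ∣ S ∣                                      ≤⟨ p⊆q⇒∣p∣≤∣q∣ S⊆below ⟩
    ∣ tabulate (λ v → does (label C v <? i)) ∣ ≡⟨ ∣preimage∣≡∑⟨⟩ (label C) (λ k → does (k <? i)) ⟩
    P                                          ∎)
    where
    open ≤-Reasoning
    P = sumBelow (compSize C) i
    S⊆below : S ⊆ tabulate (λ v → does (label C v <? i))
    S⊆below {u} u∈S = ∈-tabulate⁺ (dec-true (label C u <? i) (≰⇒> λ i≤lu → <⇒≱ s<aᵢ (begin
      compSize C i           ≤⟨ sorted i (label C u) i≤lu ⟩
      compSize C (label C u) ≤⟨ compSize≤∣closed∣ (spanning-hole-closed G hole s+t≡n) u∈S ⟩
      ∣ S ∣                  ≡⟨ ∣S∣≡s ⟩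
      suc P                  ∎)))

  condition-necessary : Sorted C → (∀ j → j < n → ¬ NoHoleAt G j) →
                        ∀ i → compSize C i ∸ 1 ≤ sumBelow (compSize C) i
  condition-necessary sorted inadmissible i with compSize C i ∸ 1 ≤? sumBelow (compSize C) i
  ... | yes aᵢ∸1≤P = aᵢ∸1≤P
  ... | no  aᵢ∸1≰P = contradiction
        (suc P , t′ , s≤s z≤n , m<n⇒0<n∸m s<n , refl , large-component⇒hole-free sorted i s<aᵢ s+t′≡n)
        (inadmissible (P + t′) (≤-reflexive s+t′≡n))
    where
    P = sumBelow (compSize C) i
    s<aᵢ = ∸1≰⇒suc< (compSize C i) aᵢ∸1≰P
    s<n = <-≤-trans s<aᵢ (∣p∣≤n (tabulate (λ v → does (label C v ≟ i))))
    t′ = n ∸ suc P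
    s+t′≡n = m+[n∸m]≡n (<⇒≤ s<n)

proposition4p1 : (n : ℕ) → 1 ≤ n → (G : Graph n) → (r : ℕ) → (C : Components G r) →
    Sorted C →
    (IsBipartiteHoleNumber G n → ∀ (i : Fin r) → compSize C i ∸ 1 ≤ prefixSum C i) ×
    ((∀ (i : Fin r) → compSize C i ∸ 1 ≤ prefixSum C i) → IsBipartiteHoleNumber G n)
proposition4p1 n 1≤n G r C sorted =
    (λ (_ , inadmissible) i →
       subst (compSize C i ∸ 1 ≤_) (≡.sym (prefixSum≡sumBelow C i))
             (condition-necessary C sorted inadmissible i))
  , (λ cond → noHoleAt-n G 1≤n ,
       condition-sufficient C (λ i → subst (compSize C i ∸ 1 ≤_) (prefixSum≡sumBelow C i) (cond i)))
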